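{- For a positive integer $n$, let \[ a_{n,0} = \left|\left\{ d \in \mathbb{Z}_{>0} \,:\, d \mid n,\ \frac{\sqrt{2n}}{2} < d \leq \sqrt{2n} \right\}\right|, \] the number of divisors $d$ of $n$ with $\sqrt{n/2} < d \le \sqrt{2n}$. Then \[ \limsup_{n\to\infty} a_{n,0} = \infty . \] More precisely, for each integer $i \geq 1$ define $s_{\max} = s_{\max}(i) = \ln(2)/\ln(1+i^{ -1})$ and \[ n(i) = 2\,(i+1)^{\lceil 2 s_{\max}\rceil}\cdot i^{\,2\lceil s_{\max}\rceil}. \] Then $\lim_{i\to\infty} a_{n(i),0} = \infty$.
   Context: $\lceil x\rceil$ denotes the least integer $\ge x$, and $\ln$ is the natural logarithm. -}

module Defs where

open import Data.Nat using (ℕ; suc; _*_; _^_; _≤_; _<_)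
open import Data.Nat.Properties using (_≤?_; _<?_)
open import Data.Nat.Divisibility using (_∣_; _∣?_)
open import Data.List using (length; filter; upTo)
open import Data.Product using (_×_)
open import Relation.Nullary.Decidable using (_×-dec_)

-- d is a divisor of n with sqrt(2n)/2 < d ≤ sqrt(2n).
-- For natural numbers: sqrt(2n)/2 < d  ⟺  n < 2 d²,  and  d ≤ sqrt(2n) ⟺ d² ≤ 2n.
-- (n < 2 d² forces d > 0.)
InWindow : ℕ → ℕ → Set
InWindow n d = (d ∣ n) × (n < 2 * (d * d)) × (d * d ≤ 2 * n)

-- Candidates d range over 0,1,…,n (every positive divisor of n > 0 is ≤ n;
-- for n = 0 the window is empty, matching the informal definition).
a0 : ℕ → ℕ
a0 n = length (filter (λ d → (d ∣? n) ×-dec ((n <? 2 * (d * d)) ×-dec (d * d ≤? 2 * n)))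
                      (upTo (suc n)))

-- IsCeilLog i c k :  k = ⌈ ln c / ln (1 + 1/i) ⌉  (for i ≥ 1, c ≥ 2),
-- i.e. k is the least natural number with (1 + 1/i)^k ≥ c,
-- i.e. with c · i^k ≤ (i+1)^k.
IsCeilLog : ℕ → ℕ → ℕ → Set
IsCeilLog i c k = (c * i ^ k ≤ suc i ^ k) × (∀ j → j < k → suc i ^ j < c * i ^ j)

-- n(i) = 2 (i+1)^{⌈2 s_max⌉} i^{2 ⌈s_max⌉}, given k1 = ⌈s_max⌉, k2 = ⌈2 s_max⌉.
nOf : ℕ → ℕ → ℕ → ℕ
nOf i k1 k2 = 2 * suc i ^ k2 * i ^ (2 * k1)

{-# OPTIONS --safe #-}
-- For j ≤ L the numbers c (i+1)^j i^(L−j) form a geometric progression of ratio 1 + 1/i, and for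
-- suitable c and L they all divide n = 2 (i+1)^k₂ i^(2k₁). If d_e ≤ √(n/2) < d_(e+1), then
-- d_(e+1), …, d_(e+K) lie in the window (√(n/2), √(2n)] as long as (1 + 1/i)^K < 2, that is for
-- every K < k₁; and k₁ > i/2 because (1 + 1/i)^m < 2 when 2m < i. One always has
-- k₂ ∈ {2k₁ − 1, 2k₁}. If k₂ = 2k₁ then n/2 is the square of the term (i(i+1))^k₁. If k₂ = 2k₁ − 1
-- the exponent of i+1 in n is odd, and a constant c of size about √i, a power of 2 or of i/2
-- taken from whichever of i, i+1 is even, recentres the progression on √(n/2).
module Submission where

open import Defs
open import Data.Nat
open import Data.Nat.Properties
open import Data.Nat.Divisibility
  using ( _∣_; divides; _∣?_; _∣0; 1∣_; ∣-refl; ∣-trans; ∣⇒≤; 0∣⇒≡0; m∣m*n; n∣m*n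
        ; *-pres-∣; *-monoʳ-∣; *-monoˡ-∣; ∣m∣n⇒∣m+n; module ∣-Reasoning)
open import Data.Nat.Tactic.RingSolver using (solve-∀)
open import Data.List using ([_]; length; filter; upTo; _++_)
open import Data.List.Properties using (upTo-∷ʳ; filter-++; length-++)
open import Data.Product using (_×_; ∃; _,_)
open import Data.Sum using (_⊎_; inj₁; inj₂; [_,_]′)
open import Function using (_∘_)
open import Level using (0ℓ)
open import Relation.Nullary using (¬_; yes; no; contradiction)
open import Relation.Nullary.Decidable using (_×-dec_)
open import Relation.Unary using (Pred; Decidable)
open import Relation.Binary.PropositionalEquality hiding ([_])
open import Algebra.Properties.CommutativeSemigroup *-commutativeSemigroup

module Counting {P : Pred ℕ 0ℓ} (P? : Decidable P) where

  count : ℕ → ℕ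
  count b = length (filter P? (upTo b))

  count-suc : ∀ b → count (suc b) ≡ count b + length (filter P? [ b ])
  count-suc b = begin
    length (filter P? (upTo (suc b)))               ≡⟨ cong (length ∘ filter P?) (upTo-∷ʳ b) ⟨
    length (filter P? (upTo b ++ [ b ]))            ≡⟨ cong length (filter-++ P? (upTo b) [ b ]) ⟩
    length (filter P? (upTo b) ++ filter P? [ b ])  ≡⟨ length-++ (filter P? (upTo b)) ⟩
    count b + length (filter P? [ b ])              ∎
    where open ≡-Reasoning

  count-≤-suc : ∀ b → count b ≤ count (suc b)
  count-≤-suc b rewrite count-suc b = m≤m+n (count b) _

  count-mono : ∀ {a b} → a ≤ b → count a ≤ count b
  count-mono a≤b = go (≤⇒≤′ a≤b)
    where
    go : ∀ {a b} → a ≤′ b → count a ≤ count b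
    go ≤′-refl      = ≤-refl
    go (≤′-step p)  = ≤-trans (go p) (count-≤-suc _)

  count-suc-hit : ∀ {b} → P b → count (suc b) ≡ suc (count b)
  count-suc-hit {b} Pb rewrite count-suc b with P? b
  ... | yes _  = +-comm (count b) 1
  ... | no ¬Pb = contradiction Pb ¬Pb

  ≤-count-increasing : (f : ℕ → ℕ) → ∀ K → (∀ m → m < K → f m < f (suc m)) →
                       (∀ m → m ≤ K → P (f m)) → suc K ≤ count (suc (f K))
  ≤-count-increasing f zero f↑ P-f rewrite count-suc-hit (P-f 0 z≤n) = s≤s z≤n
  ≤-count-increasing f (suc K) f↑ P-f rewrite count-suc-hit (P-f (suc K) ≤-refl) =
    s≤s (≤-trans (≤-count-increasing f K (λ m m<K → f↑ m (m<n⇒m<1+n m<K))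
                                         (λ m m≤K → P-f m (m≤n⇒m≤1+n m≤K)))
                 (count-mono (f↑ K (n<1+n K))))

inWindow? : ∀ n → Decidable (InWindow n)
inWindow? n d = (d ∣? n) ×-dec ((n <? 2 * (d * d)) ×-dec (d * d ≤? 2 * n))

open Counting using (count; count-mono; ≤-count-increasing)

divisor-positive : ∀ {d n} → 1 ≤ n → d ∣ n → 0 < d
divisor-positive {zero}  1≤n 0∣n = contradiction (sym (0∣⇒≡0 0∣n)) (<⇒≢ 1≤n)
divisor-positive {suc _} _   _   = z<s

crossing : ∀ {Q : Pred ℕ 0ℓ} → Decidable Q → ¬ Q 0 → ∀ T → Q T →
           ∃ λ e → e < T × ¬ Q e × Q (suc e)
crossing Q? ¬Q₀ zero    Q₀ = contradiction Q₀ ¬Q₀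
crossing Q? ¬Q₀ (suc T) Q₁₊ₜ with Q? T
... | no ¬Qₜ = T , n<1+n T , ¬Qₜ , Q₁₊ₜ
... | yes Qₜ with e , e<T , ¬Qₑ , Q₁₊ₑ ← crossing Q? ¬Q₀ T Qₜ =
  e , m<n⇒m<1+n e<T , ¬Qₑ , Q₁₊ₑ

module GeometricChain (d : ℕ → ℕ) (p q B : ℕ) .{{_ : NonZero p}}
                      (ratio : ∀ j → j < B → d (suc j) * p ≡ d j * q) where

  ratio-iterate : ∀ m j → m + j ≤ B → d (m + j) * p ^ m ≡ d j * q ^ m
  ratio-iterate zero    j _     = refl
  ratio-iterate (suc m) j bound = begin
    d (suc (m + j)) * (p * p ^ m)  ≡⟨ *-assoc (d (suc (m + j))) p (p ^ m) ⟨
    d (suc (m + j)) * p * p ^ m    ≡⟨ cong (_* p ^ m) (ratio (m + j) bound) ⟩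
    d (m + j) * q * p ^ m          ≡⟨ xy∙z≈y∙xz (d (m + j)) q (p ^ m) ⟩
    q * (d (m + j) * p ^ m)        ≡⟨ cong (q *_) (ratio-iterate m j (<⇒≤ bound)) ⟩
    q * (d j * q ^ m)              ≡⟨ x∙yz≈y∙xz q (d j) (q ^ m) ⟩
    d j * (q * q ^ m)              ∎
    where open ≡-Reasoning

  step-< : ∀ {j} → j < B → p < q → .{{NonZero (d j)}} → d j < d (suc j)
  step-< {j} j<B p<q = *-cancelʳ-< p (d j) (d (suc j)) (begin-strict
    d j * p        <⟨ *-monoʳ-< (d j) p<q ⟩
    d j * q        ≡⟨ ratio j j<B ⟨
    d (suc j) * p  ∎)
    where open ≤-Reasoning

  -- d (e+1+m) lies between d (e+1) and 2 d e, because (q/p)^(m+1) < 2.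
  window-count-from-crossing : ∀ {n e K} → 1 ≤ n → p < q → e + K ≤ B →
                               (∀ m → m ≤ K → q ^ m < 2 * p ^ m) →
                               (∀ j → j ≤ e + K → d j ∣ n) →
                               2 * (d e * d e) ≤ n → n < 2 * (d (suc e) * d (suc e)) →
                               K ≤ a0 n
  window-count-from-crossing {K = zero} _ _ _ _ _ _ _ = z≤n
  window-count-from-crossing {n} {e} {suc K} 1≤n p<q bound small dvd below above =
    ≤-trans (≤-count-increasing (inWindow? n) f K increasing (λ m m≤K → inWindow m (s≤s m≤K)))
            (count-mono (inWindow? n) (s≤s (∣⇒≤ {{>-nonZero 1≤n}} (f∣n K ≤-refl))))
    where
    f : ℕ → ℕ
    f m = d (m + suc e)

    index-≤ : ∀ {m} → m < suc K → m + suc e ≤ e + suc K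
    index-≤ {m} m<K =
      subst (_≤ e + suc K) (trans (+-comm e (suc m)) (sym (+-suc m e))) (+-monoʳ-≤ e m<K)

    index-bound : ∀ {m} → m < suc K → m + suc e ≤ B
    index-bound m<K = ≤-trans (index-≤ m<K) bound

    f∣n : ∀ m → m < suc K → f m ∣ n
    f∣n m m<K = dvd (m + suc e) (index-≤ m<K)

    increasing : ∀ m → m < K → f m < f (suc m)
    increasing m m<K = step-< (index-bound (s≤s m<K)) p<q
      where instance _ = >-nonZero (divisor-positive 1≤n (f∣n m (m<n⇒m<1+n m<K)))

    above-start : ∀ {m} → m < suc K → d (suc e) ≤ f m
    above-start {m} m<K = *-cancelʳ-≤ (d (suc e)) (f m) (p ^ m) (begin
      d (suc e) * p ^ m  ≤⟨ *-monoʳ-≤ (d (suc e)) (^-monoˡ-≤ m (<⇒≤ p<q)) ⟩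
      d (suc e) * q ^ m  ≡⟨ ratio-iterate m (suc e) (index-bound m<K) ⟨
      f m * p ^ m        ∎)
      where open ≤-Reasoning
            instance _ = m^n≢0 p m

    below-double : ∀ {m} → m < suc K → f m ≤ 2 * d e
    below-double {m} m<K = *-cancelʳ-≤ (f m) (2 * d e) (p ^ suc m) (begin
      f m * (p * p ^ m)       ≡⟨ x∙yz≈y∙xz (f m) p (p ^ m) ⟩
      p * (f m * p ^ m)       ≡⟨ cong (p *_) (ratio-iterate m (suc e) (index-bound m<K)) ⟩
      p * (d (suc e) * q ^ m) ≡⟨ x∙yz≈yx∙z p (d (suc e)) (q ^ m) ⟩
      d (suc e) * p * q ^ m   ≡⟨ cong (_* q ^ m) (ratio e (<-≤-trans (m<m+n e z<s) bound)) ⟩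
      d e * q * q ^ m         ≡⟨ *-assoc (d e) q (q ^ m) ⟩
      d e * q ^ suc m         ≤⟨ *-monoʳ-≤ (d e) (<⇒≤ (small (suc m) m<K)) ⟩
      d e * (2 * p ^ suc m)   ≡⟨ x∙yz≈yx∙z (d e) 2 (p ^ suc m) ⟩
      2 * d e * p ^ suc m     ∎)
      where open ≤-Reasoning
            instance _ = m^n≢0 p (suc m)

    inWindow : ∀ m → m < suc K → InWindow n (f m)
    inWindow m m<K = f∣n m m<K , lower , upper
      where
      lower : n < 2 * (f m * f m)
      lower = <-≤-trans above (*-monoʳ-≤ 2 (*-mono-≤ (above-start m<K) (above-start m<K)))
      upper : f m * f m ≤ 2 * n
      upper = begin
        f m * f m              ≤⟨ *-mono-≤ (below-double m<K) (below-double m<K) ⟩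
        (2 * d e) * (2 * d e)  ≡⟨ double² (d e) ⟩
        2 * (2 * (d e * d e))  ≤⟨ *-monoʳ-≤ 2 below ⟩
        2 * n                  ∎
        where
        open ≤-Reasoning
        double² : ∀ x → (2 * x) * (2 * x) ≡ 2 * (2 * (x * x))
        double² = solve-∀

  window-count-between : ∀ {n T K} → 1 ≤ n → p < q → T + K ≤ B →
                         (∀ m → m ≤ K → q ^ m < 2 * p ^ m) →
                         (∀ j → j ≤ T + K → d j ∣ n) →
                         2 * (d 0 * d 0) ≤ n → n < 2 * (d T * d T) →
                         K ≤ a0 n
  window-count-between {n} {T} {K} 1≤n p<q bound small dvd below above
    with e , e<T , ¬above , above′ ← crossing (λ j → n <? 2 * (d j * d j)) (≤⇒≯ below) T above
    = window-count-from-crossing 1≤n p<q (≤-trans e+K≤T+K bound) small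
                                 (λ j j≤e+K → dvd j (≤-trans j≤e+K e+K≤T+K)) (≮⇒≥ ¬above) above′
    where e+K≤T+K = +-monoˡ-≤ K (<⇒≤ e<T)

^-monoʳ-∣ : ∀ x {a b} → a ≤ b → x ^ a ∣ x ^ b
^-monoʳ-∣ x {a} a≤b with o , refl ← m≤n⇒∃[o]m+o≡n a≤b =
  subst (x ^ a ∣_) (sym (^-distribˡ-+-* x a o)) (m∣m*n (x ^ o))

^-monoˡ-∣ : ∀ {x y} e → x ∣ y → x ^ e ∣ y ^ e
^-monoˡ-∣ zero    _   = ∣-refl
^-monoˡ-∣ (suc e) x∣y = *-pres-∣ x∣y (^-monoˡ-∣ e x∣y)

^-distribʳ-* : ∀ x y e → (x * y) ^ e ≡ x ^ e * y ^ e
^-distribʳ-* x y zero    = refl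
^-distribʳ-* x y (suc e) = begin
  x * y * (x * y) ^ e       ≡⟨ cong (x * y *_) (^-distribʳ-* x y e) ⟩
  x * y * (x ^ e * y ^ e)   ≡⟨ shuffle x y (x ^ e) (y ^ e) ⟩
  x * x ^ e * (y * y ^ e)   ∎
  where
  open ≡-Reasoning
  shuffle : ∀ x y a b → x * y * (a * b) ≡ x * a * (y * b)
  shuffle = solve-∀

^-double : ∀ x k → x ^ (2 * k) ≡ x ^ k * x ^ k
^-double x k = trans (cong (x ^_) (cong (k +_) (+-identityʳ k))) (^-distribˡ-+-* x k k)

m*n≤m^n : ∀ m n → 1 < m → m * n ≤ m ^ n
m*n≤m^n m zero          _   = subst (_≤ 1) (sym (*-zeroʳ m)) z≤n
m*n≤m^n m (suc zero)    _   = ≤-refl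
m*n≤m^n m (suc (suc n)) 1<m = begin
  m * suc (suc n)            ≡⟨ *-suc m (suc n) ⟩
  m + m * suc n              ≤⟨ +-mono-≤ m≤mᵏ (m*n≤m^n m (suc n) 1<m) ⟩
  m ^ suc n + m ^ suc n      ≡⟨ cong (m ^ suc n +_) (+-identityʳ (m ^ suc n)) ⟨
  2 * m ^ suc n              ≤⟨ *-monoˡ-≤ (m ^ suc n) 1<m ⟩
  m * m ^ suc n              ∎
  where
  open ≤-Reasoning
  m≤mᵏ : m ≤ m ^ suc n
  m≤mᵏ = subst (_≤ m ^ suc n) (*-identityʳ m) (*-monoʳ-≤ m (m^n>0 m n))
    where instance _ = >-nonZero (<-trans z<s 1<m)

⌊log⌋-bounds : ∀ b → 1 < b → ∀ n → ∃ λ e → b ^ e ≤ suc n × suc n < b * b ^ e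
⌊log⌋-bounds b 1<b zero = 0 , ≤-refl , subst (1 <_) (sym (*-identityʳ b)) 1<b
⌊log⌋-bounds b 1<b (suc n) with e , bᵉ≤1+n , 1+n<b*bᵉ ← ⌊log⌋-bounds b 1<b n
  with suc (suc n) <? b * b ^ e
... | yes 2+n<b*bᵉ = e , m≤n⇒m≤1+n bᵉ≤1+n , 2+n<b*bᵉ
... | no 2+n≮b*bᵉ = suc e , ≤-reflexive (sym 2+n≡b*bᵉ) , (begin-strict
  suc (suc n)        ≡⟨ 2+n≡b*bᵉ ⟩
  b * b ^ e          <⟨ m<m*n (b * b ^ e) b 1<b ⟩
  b * b ^ e * b      ≡⟨ *-comm (b * b ^ e) b ⟩
  b * (b * b ^ e)    ∎)
  where
  open ≤-Reasoning
  2+n≡b*bᵉ : suc (suc n) ≡ b * b ^ e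
  2+n≡b*bᵉ = ≤-antisym 1+n<b*bᵉ (≮⇒≥ 2+n≮b*bᵉ)
  instance
    _ = >-nonZero (<-trans z<s 1<b)
    _ = m^n≢0 b e
    _ = m*n≢0 b (b ^ e)

2∣n⊎2∣1+n : ∀ i → 2 ∣ i ⊎ 2 ∣ suc i
2∣n⊎2∣1+n zero    = inj₁ (2 ∣0)
2∣n⊎2∣1+n (suc i) with 2∣n⊎2∣1+n i
... | inj₁ 2∣i   = inj₂ (∣m∣n⇒∣m+n (∣-refl {2}) 2∣i)
... | inj₂ 2∣1+i = inj₁ 2∣1+i

chain : (c p q L : ℕ) → ℕ → ℕ
chain c p q L j = c * (q ^ j * p ^ (L ∸ j))

chain-ratio : ∀ c p q L j → j < L → chain c p q L (suc j) * p ≡ chain c p q L j * q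
chain-ratio c p q L j j<L = begin
  c * (q * q ^ j * p ^ (L ∸ suc j)) * p    ≡⟨ shuffle c q (q ^ j) (p ^ (L ∸ suc j)) p ⟩
  c * (q ^ j * (p * p ^ (L ∸ suc j))) * q  ≡⟨ cong (λ r → c * (q ^ j * p ^ r) * q) (+-∸-assoc 1 j<L) ⟨
  c * (q ^ j * p ^ (L ∸ j)) * q            ∎
  where
  open ≡-Reasoning
  shuffle : ∀ c q x y p → c * (q * x * y) * p ≡ c * (x * (p * y)) * q
  shuffle = solve-∀

chain-at : ∀ c p q {L} T R → T + R ≡ L → chain c p q L T ≡ c * (q ^ T * p ^ R)
chain-at c p q T R refl = cong (λ r → c * (q ^ T * p ^ r)) (m+n∸m≡n T R)

nOf-positive : ∀ i .{{_ : NonZero i}} k₁ k₂ → 1 ≤ nOf i k₁ k₂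
nOf-positive i k₁ k₂ = >-nonZero⁻¹ (nOf i k₁ k₂)
  where
  instance
    _ = m^n≢0 (suc i) k₂
    _ = m^n≢0 i (2 * k₁)
    _ = m*n≢0 2 (suc i ^ k₂)
    _ = m*n≢0 (2 * suc i ^ k₂) (i ^ (2 * k₁))

chain-∣-nOf : ∀ {c i α β L j k₁ k₂} → c ∣ 2 * (suc i ^ α * i ^ β) →
              j + α ≤ k₂ → (L ∸ j) + β ≤ 2 * k₁ → chain c i (suc i) L j ∣ nOf i k₁ k₂
chain-∣-nOf {c} {i} {α} {β} {L} {j} {k₁} {k₂} c∣ j+α≤k₂ r+β≤2k₁ = begin
  c * (suc i ^ j * i ^ (L ∸ j))
    ∣⟨ *-monoˡ-∣ _ c∣ ⟩
  2 * (suc i ^ α * i ^ β) * (suc i ^ j * i ^ (L ∸ j))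
    ≡⟨ shuffle (suc i ^ α) (i ^ β) (suc i ^ j) (i ^ (L ∸ j)) ⟩
  2 * (suc i ^ j * suc i ^ α) * (i ^ (L ∸ j) * i ^ β)
    ≡⟨ cong₂ (λ x y → 2 * x * y) (^-distribˡ-+-* (suc i) j α) (^-distribˡ-+-* i (L ∸ j) β) ⟨
  2 * suc i ^ (j + α) * i ^ ((L ∸ j) + β)
    ∣⟨ *-pres-∣ (*-monoʳ-∣ 2 (^-monoʳ-∣ (suc i) j+α≤k₂)) (^-monoʳ-∣ i r+β≤2k₁) ⟩
  2 * suc i ^ k₂ * i ^ (2 * k₁)
    ∎
  where
  open ∣-Reasoning
  shuffle : ∀ A B C D → 2 * (A * B) * (C * D) ≡ 2 * (C * A) * (D * B)
  shuffle = solve-∀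

[1+i]^m*[i∸m]≤i*i^m : ∀ i m → suc i ^ m * (i ∸ m) ≤ i * i ^ m
[1+i]^m*[i∸m]≤i*i^m i zero = ≤-reflexive (trans (+-identityʳ i) (sym (*-identityʳ i)))
[1+i]^m*[i∸m]≤i*i^m i (suc m) = begin
  suc i * suc i ^ m * (i ∸ suc m)    ≡⟨ xy∙z≈y∙xz (suc i) (suc i ^ m) (i ∸ suc m) ⟩
  suc i ^ m * (suc i * (i ∸ suc m))  ≤⟨ *-monoʳ-≤ (suc i ^ m) step ⟩
  suc i ^ m * (i * (i ∸ m))          ≡⟨ x∙yz≈y∙xz (suc i ^ m) i (i ∸ m) ⟩
  i * (suc i ^ m * (i ∸ m))          ≤⟨ *-monoʳ-≤ i ([1+i]^m*[i∸m]≤i*i^m i m) ⟩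
  i * (i * i ^ m)                    ∎
  where
  open ≤-Reasoning
  step : suc i * (i ∸ suc m) ≤ i * (i ∸ m)
  step with m <? i
  ... | yes m<i = begin
    (i ∸ suc m) + i * (i ∸ suc m)  ≤⟨ +-monoˡ-≤ (i * (i ∸ suc m)) (m∸n≤m i (suc m)) ⟩
    i + i * (i ∸ suc m)            ≡⟨ *-suc i (i ∸ suc m) ⟨
    i * suc (i ∸ suc m)            ≡⟨ cong (i *_) (+-∸-assoc 1 m<i) ⟨
    i * (i ∸ m)                    ∎
  ... | no m≮i rewrite m≤n⇒m∸n≡0 (m≤n⇒m≤1+n (≮⇒≥ m≮i)) | *-zeroʳ (suc i) = z≤n

[1+i]^m<2*i^m : ∀ i m → 2 * m < i → suc i ^ m < 2 * i ^ m
[1+i]^m<2*i^m i m 2m<i = *-cancelʳ-< i (suc i ^ m) (2 * i ^ m) (begin-strict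
  suc i ^ m * i              <⟨ *-monoʳ-< (suc i ^ m) i<2[i∸m] ⟩
  suc i ^ m * (2 * (i ∸ m))  ≡⟨ x∙yz≈y∙xz (suc i ^ m) 2 (i ∸ m) ⟩
  2 * (suc i ^ m * (i ∸ m))  ≤⟨ *-monoʳ-≤ 2 ([1+i]^m*[i∸m]≤i*i^m i m) ⟩
  2 * (i * i ^ m)            ≡⟨ x∙yz≈xz∙y 2 i (i ^ m) ⟩
  2 * i ^ m * i              ∎)
  where
  open ≤-Reasoning
  instance _ = m^n≢0 (suc i) m
  m<i∸m : m < i ∸ m
  m<i∸m = m+n≤o⇒m≤o∸n (suc m) (subst (_≤ i) (cong suc (cong (m +_) (+-identityʳ m))) 2m<i)
  i<2[i∸m] : i < 2 * (i ∸ m)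
  i<2[i∸m] = begin-strict
    i                  ≡⟨ m∸n+n≡m (≤-trans (m≤m+n m (m + 0)) (<⇒≤ 2m<i)) ⟨
    (i ∸ m) + m        <⟨ +-monoʳ-< (i ∸ m) m<i∸m ⟩
    (i ∸ m) + (i ∸ m)  ≡⟨ cong ((i ∸ m) +_) (+-identityʳ (i ∸ m)) ⟨
    2 * (i ∸ m)        ∎

^-ratio-mono : ∀ c {a b k l} → a ≤ b → k ≤ l → c * a ^ k ≤ b ^ k → c * a ^ l ≤ b ^ l
^-ratio-mono c {a} {b} {k} a≤b k≤l c*aᵏ≤bᵏ
  with o , refl ← m≤n⇒∃[o]m+o≡n k≤l = begin
  c * a ^ (k + o)        ≡⟨ cong (c *_) (^-distribˡ-+-* a k o) ⟩
  c * (a ^ k * a ^ o)    ≡⟨ *-assoc c (a ^ k) (a ^ o) ⟨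
  c * a ^ k * a ^ o      ≤⟨ *-mono-≤ c*aᵏ≤bᵏ (^-monoˡ-≤ o a≤b) ⟩
  b ^ k * b ^ o          ≡⟨ ^-distribˡ-+-* b k o ⟨
  b ^ (k + o)            ∎
  where open ≤-Reasoning

<-ceilLog : ∀ {i c k m} → IsCeilLog i c k → suc i ^ m < c * i ^ m → m < k
<-ceilLog {i} {c} {k} {m} (c*iᵏ≤sᵏ , _) sᵐ<c*iᵐ with m <? k
... | yes m<k = m<k
... | no m≮k  =
  contradiction (^-ratio-mono c (n≤1+n i) (≮⇒≥ m≮k) c*iᵏ≤sᵏ) (<⇒≱ sᵐ<c*iᵐ)

2*m<i⇒m<ceilLog : ∀ {i k m} → IsCeilLog i 2 k → 2 * m < i → m < k
2*m<i⇒m<ceilLog {i} {m = m} ceil 2m<i = <-ceilLog {c = 2} ceil ([1+i]^m<2*i^m i m 2m<i)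

ceilLog-square : ∀ {i c k k′} → IsCeilLog i c k → IsCeilLog i (c * c) k′ →
                 k′ ≤ 2 * k × 2 * k ≤ suc k′
ceilLog-square {i} {c} {k} {k′} (c*iᵏ≤sᵏ , minimal) ceilLog′@(_ , minimal′) =
  k′≤2k , 2k≤1+k′ k minimal
  where
  squared : ∀ m → (c * i ^ m) * (c * i ^ m) ≡ c * c * i ^ (2 * m)
  squared m = trans (shuffle c (i ^ m)) (cong (c * c *_) (sym (^-double i m)))
    where shuffle : ∀ c x → (c * x) * (c * x) ≡ c * c * (x * x)
          shuffle = solve-∀

  k′≤2k : k′ ≤ 2 * k
  k′≤2k with k′ ≤? 2 * k
  ... | yes k′≤2k = k′≤2k
  ... | no k′≰2k  = contradiction (minimal′ (2 * k) (≰⇒> k′≰2k)) (≤⇒≯ (begin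
    c * c * i ^ (2 * k)         ≡⟨ squared k ⟨
    (c * i ^ k) * (c * i ^ k)   ≤⟨ *-mono-≤ c*iᵏ≤sᵏ c*iᵏ≤sᵏ ⟩
    suc i ^ k * suc i ^ k       ≡⟨ ^-double (suc i) k ⟨
    suc i ^ (2 * k)             ∎))
    where open ≤-Reasoning

  2k≤1+k′ : ∀ k → (∀ j → j < k → suc i ^ j < c * i ^ j) → 2 * k ≤ suc k′
  2k≤1+k′ zero    _       = z≤n
  2k≤1+k′ (suc j) sᵐ<c*iᵐ =
    s≤s (subst (_≤ k′) (sym (+-suc j (j + 0))) (<-ceilLog {c = c * c} ceilLog′ (begin-strict
      suc i ^ (2 * j)             ≡⟨ ^-double (suc i) j ⟩
      suc i ^ j * suc i ^ j       <⟨ *-mono-< sʲ<c*iʲ sʲ<c*iʲ ⟩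
      (c * i ^ j) * (c * i ^ j)   ≡⟨ squared j ⟩
      c * c * i ^ (2 * j)         ∎)))
    where open ≤-Reasoning
          sʲ<c*iʲ = sᵐ<c*iᵐ j (n<1+n j)

2[m+e]<i : ∀ {m e i} → 4 * m < i → 4 ^ e ≤ i → 2 * (m + e) < i
2[m+e]<i {m} {e} {i} 4m<i 4ᵉ≤i = *-cancelˡ-< 2 (2 * (m + e)) i (begin-strict
  2 * (2 * (m + e))  ≡⟨ distrib m e ⟩
  4 * m + 4 * e      <⟨ +-mono-<-≤ 4m<i (≤-trans (m*n≤m^n 4 e (s≤s (s≤s z≤n))) 4ᵉ≤i) ⟩
  i + i              ≡⟨ cong (i +_) (+-identityʳ i) ⟨
  2 * i              ∎)
  where
  open ≤-Reasoning
  distrib : ∀ m e → 2 * (2 * (m + e)) ≡ 4 * m + 4 * e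
  distrib = solve-∀

a0-nOf-square : ∀ i .{{_ : NonZero i}} k → (∀ m → m ≤ k → suc i ^ m < 2 * i ^ m) →
                k ≤ a0 (nOf i (suc k) (2 * suc k))
a0-nOf-square i k small =
  window-count-from-crossing 1≤n (n<1+n i) k₁+k≤L small dvd (≤-reflexive (sym n≡2d²)) above
  where
  k₁ = suc k
  L = 2 * k₁
  n = nOf i k₁ L
  d = chain 1 i (suc i) L
  open GeometricChain d i (suc i) L (chain-ratio 1 i (suc i) L)
  1≤n = nOf-positive i k₁ L
  k₁+k₁≡L : k₁ + k₁ ≡ L
  k₁+k₁≡L = cong (k₁ +_) (sym (+-identityʳ k₁))
  k₁+k≤L : k₁ + k ≤ L
  k₁+k≤L = ≤-trans (+-monoʳ-≤ k₁ (n≤1+n k)) (≤-reflexive k₁+k₁≡L)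

  dvd : ∀ j → j ≤ k₁ + k → d j ∣ n
  dvd j j≤k₁+k = chain-∣-nOf {α = 0} {β = 0} {k₁ = k₁} {k₂ = L} (1∣ _)
    (subst (_≤ L) (sym (+-identityʳ j)) (≤-trans j≤k₁+k k₁+k≤L))
    (subst (_≤ L) (sym (+-identityʳ (L ∸ j))) (m∸n≤m L j))

  n≡2d² : n ≡ 2 * (d k₁ * d k₁)
  n≡2d² = begin
    2 * suc i ^ L * i ^ L
      ≡⟨ cong₂ (λ x y → 2 * x * y) (^-double (suc i) k₁) (^-double i k₁) ⟩
    2 * (suc i ^ k₁ * suc i ^ k₁) * (i ^ k₁ * i ^ k₁)
      ≡⟨ shuffle (suc i ^ k₁) (i ^ k₁) ⟩
    2 * (1 * (suc i ^ k₁ * i ^ k₁) * (1 * (suc i ^ k₁ * i ^ k₁)))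
      ≡⟨ cong (λ x → 2 * (x * x)) (chain-at 1 i (suc i) k₁ k₁ k₁+k₁≡L) ⟨
    2 * (d k₁ * d k₁)
      ∎
    where
    open ≡-Reasoning
    shuffle : ∀ S I → 2 * (S * S) * (I * I) ≡ 2 * (1 * (S * I) * (1 * (S * I)))
    shuffle = solve-∀

  above : n < 2 * (d (suc k₁) * d (suc k₁))
  above = subst (_< 2 * (d (suc k₁) * d (suc k₁))) (sym n≡2d²)
            (*-monoʳ-< 2 (*-mono-< d<d′ d<d′))
    where
    instance _ = >-nonZero (divisor-positive 1≤n (dvd k₁ (m≤m+n k₁ k)))
    d<d′ = step-< (<-≤-trans (m<m+n k₁ z<s) (≤-reflexive k₁+k₁≡L)) (n<1+n i)

-- With 4^e ≤ i < 4^(e+1) the constant c = 2^(e+1) here, or c = (i/2)^e in the next lemma, is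
-- √i up to a factor 2, which is what the odd exponent k₂ of i+1 in n requires.
a0-nOf-[1+i]-even : ∀ i .{{_ : NonZero i}} e t → 2 ∣ suc i →
                    2 ^ e * 2 ^ e ≤ i → i < 4 * (2 ^ e * 2 ^ e) →
                    4 * i ^ (suc (e + t) + (e + t)) ≤ suc i ^ (suc (e + t) + (e + t)) →
                    (∀ m → m ≤ t → suc i ^ m < 2 * i ^ m) →
                    t ≤ a0 (nOf i (suc (e + t)) (suc (e + t) + (e + t)))
a0-nOf-[1+i]-even i e t 2∣s P²≤i i<4P² 4iᵏ≤sᵏ small =
  window-count-between 1≤n (n<1+n i) (+-monoʳ-≤ k₁ (m≤n+m t e)) small dvd below above
  where
  u = e + t
  k₁ = suc u
  k₂ = k₁ + u
  s = suc i
  n = nOf i k₁ k₂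
  P = 2 ^ e
  S = s ^ u
  I = i ^ u
  d = chain (2 * P) i s k₂
  open GeometricChain d i s k₂ (chain-ratio (2 * P) i s k₂)
  1≤n = nOf-positive i k₁ k₂

  d₀≡ : 1 * i ^ k₂ ≡ i * I * I
  d₀≡ = trans (*-identityˡ (i ^ k₂)) (^-distribˡ-+-* i k₁ u)

  dₖ≡ : d k₁ ≡ 2 * P * (s * S * I)
  dₖ≡ = chain-at (2 * P) i s k₁ u refl

  dvd : ∀ j → j ≤ k₁ + t → d j ∣ n
  dvd j j≤k₁+t = chain-∣-nOf {α = e} {β = 0} {k₁ = k₁} {k₂ = k₂}
    (*-monoʳ-∣ 2 (∣-trans (^-monoˡ-∣ e 2∣s) (m∣m*n 1)))
    (≤-trans (+-monoˡ-≤ e j≤k₁+t) (≤-reflexive (k₁+t+e≡k₂ e t)))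
    (subst (_≤ 2 * k₁) (sym (+-identityʳ (k₂ ∸ j))) (≤-trans (m∸n≤m k₂ j) (k₂≤2k₁ e t)))
    where
    k₁+t+e≡k₂ : ∀ e t → suc (e + t) + t + e ≡ suc (e + t) + (e + t)
    k₁+t+e≡k₂ = solve-∀
    k₂≤2k₁ : ∀ e t → suc (e + t) + (e + t) ≤ 2 * suc (e + t)
    k₂≤2k₁ e t = ≤-trans (n≤1+n _) (≤-reflexive (k₂+1≡2k₁ e t))
      where k₂+1≡2k₁ : ∀ e t → suc (suc (e + t) + (e + t)) ≡ 2 * suc (e + t)
            k₂+1≡2k₁ = solve-∀

  n≡ : n ≡ 2 * (s * S * S) * ((i * I) * (i * I))
  n≡ = cong₂ (λ x y → 2 * x * y) (^-distribˡ-+-* s k₁ u) (^-double i k₁)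

  4iII≤sSS : 4 * (i * I * I) ≤ s * S * S
  4iII≤sSS = subst₂ _≤_ (cong (4 *_) (^-distribˡ-+-* i k₁ u)) (^-distribˡ-+-* s k₁ u) 4iᵏ≤sᵏ

  below : 2 * (d 0 * d 0) ≤ n
  below = begin
    2 * (d 0 * d 0)
      ≡⟨ cong (λ x → 2 * (2 * P * x * (2 * P * x))) d₀≡ ⟩
    2 * (2 * P * (i * I * I) * (2 * P * (i * I * I)))
      ≡⟨ shuffle₁ P i I ⟩
    2 * (P * P * (4 * (I * I) * ((i * I) * (i * I))))
      ≤⟨ *-monoʳ-≤ 2 (*-monoˡ-≤ _ P²≤i) ⟩
    2 * (i * (4 * (I * I) * ((i * I) * (i * I))))
      ≡⟨ shuffle₂ i I ⟩
    2 * (4 * (i * I * I)) * ((i * I) * (i * I))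
      ≤⟨ *-monoˡ-≤ ((i * I) * (i * I)) (*-monoʳ-≤ 2 4iII≤sSS) ⟩
    2 * (s * S * S) * ((i * I) * (i * I))
      ≡⟨ n≡ ⟨
    n ∎
    where
    open ≤-Reasoning
    shuffle₁ : ∀ P i I → 2 * (2 * P * (i * I * I) * (2 * P * (i * I * I)))
                         ≡ 2 * (P * P * (4 * (I * I) * ((i * I) * (i * I))))
    shuffle₁ = solve-∀
    shuffle₂ : ∀ i I → 2 * (i * (4 * (I * I) * ((i * I) * (i * I))))
                       ≡ 2 * (4 * (i * I * I)) * ((i * I) * (i * I))
    shuffle₂ = solve-∀

  above : n < 2 * (d k₁ * d k₁)
  above = begin-strict
    n                                                   ≡⟨ n≡ ⟩
    2 * (s * S * S) * ((i * I) * (i * I))               ≡⟨ shuffle₁ s S i I ⟩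
    (i * i) * Y                                         <⟨ *-monoˡ-< Y (*-mono-< i<4P² (n<1+n i)) ⟩
    (4 * (P * P) * s) * Y                               ≡⟨ shuffle₂ P s S I ⟩
    2 * (2 * P * (s * S * I) * (2 * P * (s * S * I)))   ≡⟨ cong (λ x → 2 * (x * x)) dₖ≡ ⟨
    2 * (d k₁ * d k₁)                                   ∎
    where
    open ≤-Reasoning
    Y = 2 * (s * S * S * I * I)
    shuffle₁ : ∀ s S i I → 2 * (s * S * S) * ((i * I) * (i * I)) ≡ (i * i) * (2 * (s * S * S * I * I))
    shuffle₁ = solve-∀
    shuffle₂ : ∀ P s S I → (4 * (P * P) * s) * (2 * (s * S * S * I * I))
                           ≡ 2 * (2 * P * (s * S * I) * (2 * P * (s * S * I)))
    shuffle₂ = solve-∀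
    instance _ = m*n≢0⇒n≢0 (i * i) {{>-nonZero (subst (0 <_) (trans n≡ (shuffle₁ s S i I)) 1≤n)}}

a0-nOf-i-even : ∀ i .{{_ : NonZero i}} e t → 2 ∣ i →
                2 ^ e * 2 ^ e ≤ i → i < 4 * (2 ^ e * 2 ^ e) →
                4 * i ^ (suc (e + t) + (e + t)) ≤ suc i ^ (suc (e + t) + (e + t)) →
                (∀ m → m ≤ t → suc i ^ m < 2 * i ^ m) →
                t ≤ a0 (nOf i (suc (e + t)) (suc (e + t) + (e + t)))
a0-nOf-i-even i e t (divides F i≡F*2) P²≤i i<4P² 4iᵏ≤sᵏ small =
  window-count-between 1≤n (n<1+n i) (+-monoʳ-≤ k₁ (n≤1+n t)) small dvd below above
  where
  u = e + t
  k₁ = suc u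
  k₂ = k₁ + u
  L = k₁ + suc t
  s = suc i
  n = nOf i k₁ k₂
  P = 2 ^ e
  S = s ^ u
  I = i ^ u
  X = i * I
  instance
    _ = m^n≢0 2 e
    _ = m*n≢0 P P
  d = chain (F ^ e) i s L
  open GeometricChain d i s L (chain-ratio (F ^ e) i s L)
  1≤n = nOf-positive i k₁ k₂

  F∣i : F ∣ i
  F∣i = divides 2 (trans i≡F*2 (*-comm F 2))

  Fᵉ*P≡iᵉ : F ^ e * P ≡ i ^ e
  Fᵉ*P≡iᵉ = trans (sym (^-distribʳ-* F 2 e)) (cong (_^ e) (sym i≡F*2))

  e+L≡k₁+k₁ : ∀ e t → e + (suc (e + t) + suc t) ≡ suc (e + t) + suc (e + t)
  e+L≡k₁+k₁ = solve-∀
  P*d₀≡X² : F ^ e * P * (1 * i ^ L) ≡ X * X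
  P*d₀≡X² = begin
    F ^ e * P * (1 * i ^ L)  ≡⟨ cong₂ _*_ Fᵉ*P≡iᵉ (*-identityˡ (i ^ L)) ⟩
    i ^ e * i ^ L            ≡⟨ ^-distribˡ-+-* i e L ⟨
    i ^ (e + L)              ≡⟨ cong (i ^_) (e+L≡k₁+k₁ e t) ⟩
    i ^ (k₁ + k₁)            ≡⟨ ^-distribˡ-+-* i k₁ k₁ ⟩
    X * X                    ∎
    where open ≡-Reasoning

  dvd : ∀ j → j ≤ k₁ + t → d j ∣ n
  dvd j j≤k₁+t = chain-∣-nOf {α = 0} {β = e} {k₁ = k₁} {k₂ = k₂}
    (∣-trans (^-monoˡ-∣ e F∣i) (∣-trans (n∣m*n 1) (n∣m*n 2)))
    (subst (_≤ k₂) (sym (+-identityʳ j)) (≤-trans j≤k₁+t (+-monoʳ-≤ k₁ (m≤n+m t e))))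
    (≤-trans (+-monoˡ-≤ e (m∸n≤m L j)) (≤-reflexive (L+e≡2k₁ e t)))
    where L+e≡2k₁ : ∀ e t → suc (e + t) + suc t + e ≡ 2 * suc (e + t)
          L+e≡2k₁ = solve-∀

  n≡ : n ≡ 2 * (s * S * S) * (X * X)
  n≡ = cong₂ (λ x y → 2 * x * y) (^-distribˡ-+-* s k₁ u) (^-double i k₁)

  4iII≤sSS : 4 * (i * I * I) ≤ s * S * S
  4iII≤sSS = subst₂ _≤_ (cong (4 *_) (^-distribˡ-+-* i k₁ u)) (^-distribˡ-+-* s k₁ u) 4iᵏ≤sᵏ

  X²≤P²sSS : X * X ≤ P * P * (s * S * S)
  X²≤P²sSS = *-cancelˡ-≤ 4 (begin
    4 * (X * X)               ≡⟨ shuffle i I ⟩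
    i * (4 * (i * I * I))     ≤⟨ *-monoʳ-≤ i 4iII≤sSS ⟩
    i * (s * S * S)           ≤⟨ *-monoˡ-≤ (s * S * S) (<⇒≤ i<4P²) ⟩
    4 * (P * P) * (s * S * S) ≡⟨ *-assoc 4 (P * P) (s * S * S) ⟩
    4 * (P * P * (s * S * S)) ∎)
    where
    open ≤-Reasoning
    shuffle : ∀ i I → 4 * ((i * I) * (i * I)) ≡ i * (4 * (i * I * I))
    shuffle = solve-∀

  -- Both bounds are multiplied by P * P = 4^e, which turns (i/2)^e into i^e.
  below : 2 * (d 0 * d 0) ≤ n
  below = *-cancelˡ-≤ (P * P) (begin
    P * P * (2 * (d 0 * d 0))
      ≡⟨ shuffle (F ^ e) P (1 * i ^ L) ⟩
    2 * ((F ^ e * P * (1 * i ^ L)) * (F ^ e * P * (1 * i ^ L)))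
      ≡⟨ cong (λ x → 2 * (x * x)) P*d₀≡X² ⟩
    2 * ((X * X) * (X * X))
      ≤⟨ *-monoʳ-≤ 2 (*-monoˡ-≤ (X * X) X²≤P²sSS) ⟩
    2 * ((P * P * (s * S * S)) * (X * X))
      ≡⟨ shuffle′ P (s * S * S) (X * X) ⟩
    P * P * (2 * (s * S * S) * (X * X))
      ≡⟨ cong (P * P *_) n≡ ⟨
    P * P * n ∎)
    where
    open ≤-Reasoning
    shuffle : ∀ c P x → P * P * (2 * (c * x * (c * x))) ≡ 2 * ((c * P * x) * (c * P * x))
    shuffle = solve-∀
    shuffle′ : ∀ P y z → 2 * ((P * P * y) * z) ≡ P * P * (2 * y * z)
    shuffle′ = solve-∀

  above : n < 2 * (d k₁ * d k₁)
  above = *-cancelˡ-< (P * P) n (2 * (d k₁ * d k₁)) (begin-strict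
    P * P * n
      ≡⟨ cong (P * P *_) n≡ ⟩
    P * P * (2 * (s * S * S) * (X * X))
      <⟨ *-monoˡ-< Z (s≤s P²≤i) ⟩
    s * Z
      ≡⟨ shuffle s S X ⟩
    2 * ((X * (s * S)) * (X * (s * S)))
      ≡⟨ cong (λ x → 2 * ((x * (s * S)) * (x * (s * S)))) P*Iₜ≡X ⟨
    2 * ((F ^ e * P * Iₜ * (s * S)) * (F ^ e * P * Iₜ * (s * S)))
      ≡⟨ shuffle′ (F ^ e) P Iₜ (s * S) ⟩
    P * P * (2 * (F ^ e * (s * S * Iₜ) * (F ^ e * (s * S * Iₜ))))
      ≡⟨ cong (λ x → P * P * (2 * (x * x))) (chain-at (F ^ e) i s k₁ (suc t) refl) ⟨
    P * P * (2 * (d k₁ * d k₁)) ∎)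
    where
    open ≤-Reasoning
    Z = 2 * (s * S * S) * (X * X)
    Iₜ = i ^ suc t
    instance _ = >-nonZero (subst (0 <_) n≡ 1≤n)
    shuffle : ∀ s S X → s * (2 * (s * S * S) * (X * X)) ≡ 2 * ((X * (s * S)) * (X * (s * S)))
    shuffle = solve-∀
    shuffle′ : ∀ c P Iₜ y → 2 * ((c * P * Iₜ * y) * (c * P * Iₜ * y))
                            ≡ P * P * (2 * (c * (y * Iₜ) * (c * (y * Iₜ))))
    shuffle′ = solve-∀
    P*Iₜ≡X : F ^ e * P * Iₜ ≡ X
    P*Iₜ≡X = trans (cong (_* Iₜ) Fᵉ*P≡iᵉ)
                   (trans (sym (^-distribˡ-+-* i e (suc t))) (cong (i ^_) (+-suc e t)))

a0-nOf-odd : ∀ i .{{_ : NonZero i}} e t → 4 ^ e ≤ i → i < 4 * 4 ^ e →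
             4 * i ^ (suc (e + t) + (e + t)) ≤ suc i ^ (suc (e + t) + (e + t)) →
             (∀ m → m ≤ t → suc i ^ m < 2 * i ^ m) →
             t ≤ a0 (nOf i (suc (e + t)) (suc (e + t) + (e + t)))
a0-nOf-odd i e t 4ᵉ≤i i<4*4ᵉ 4iᵏ≤sᵏ small =
  [ (λ 2∣i → a0-nOf-i-even i e t 2∣i P²≤i i<4P² 4iᵏ≤sᵏ small)
  , (λ 2∣s → a0-nOf-[1+i]-even i e t 2∣s P²≤i i<4P² 4iᵏ≤sᵏ small)
  ]′ (2∣n⊎2∣1+n i)
  where
  P²≤i = subst (_≤ i) (^-distribʳ-* 2 2 e) 4ᵉ≤i
  i<4P² = subst (λ x → i < 4 * x) (^-distribʳ-* 2 2 e) i<4*4ᵉ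

M≤a0-nOf-square : ∀ {M i k₁} .{{_ : NonZero i}} → M < k₁ →
                  (∀ m → m < k₁ → suc i ^ m < 2 * i ^ m) → M ≤ a0 (nOf i k₁ (2 * k₁))
M≤a0-nOf-square {i = i} {suc k} (s≤s M≤k) small =
  ≤-trans M≤k (a0-nOf-square i k (λ m m≤k → small m (s≤s m≤k)))

M≤a0-nOf-odd : ∀ {M i k₁ k₂} → 4 * M < i → IsCeilLog i 2 k₁ → 4 * i ^ k₂ ≤ suc i ^ k₂ →
               suc k₂ ≡ 2 * k₁ → M ≤ a0 (nOf i k₁ k₂)
M≤a0-nOf-odd {i = zero} ()
M≤a0-nOf-odd {M} {i@(suc i′)} {k₂ = k₂} 4M<i ceil₁@(_ , small) 4iᵏ≤sᵏ 1+k₂≡2k₁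
  with e , 4ᵉ≤i , i<4*4ᵉ ← ⌊log⌋-bounds 4 (s≤s (s≤s z≤n)) i′
  with o , refl ← m≤n⇒∃[o]m+o≡n (2*m<i⇒m<ceilLog {m = M + e} ceil₁ (2[m+e]<i {M} 4M<i 4ᵉ≤i))
  = subst₂ (λ a b → M ≤ a0 (nOf i a b)) (k₁≡ M e o) k₂≡
      (≤-trans (m≤m+n M o) (a0-nOf-odd i e t 4ᵉ≤i i<4*4ᵉ 4iᵏ≤sᵏ′ small′))
  where
  t = M + o
  k₁≡ : ∀ M e o → suc (e + (M + o)) ≡ suc (M + e) + o
  k₁≡ = solve-∀
  2k₁≡ : ∀ M e o → suc (suc (e + (M + o)) + (e + (M + o))) ≡ 2 * (suc (M + e) + o)
  2k₁≡ = solve-∀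
  k₂≡ : suc (e + t) + (e + t) ≡ k₂
  k₂≡ = suc-injective (trans (2k₁≡ M e o) (sym 1+k₂≡2k₁))
  4iᵏ≤sᵏ′ : 4 * i ^ (suc (e + t) + (e + t)) ≤ suc i ^ (suc (e + t) + (e + t))
  4iᵏ≤sᵏ′ = subst (λ k → 4 * i ^ k ≤ suc i ^ k) (sym k₂≡) 4iᵏ≤sᵏ
  small′ : ∀ m → m ≤ t → suc i ^ m < 2 * i ^ m
  small′ m m≤t = small m (s≤s (≤-trans m≤t (+-monoˡ-≤ o (m≤m+n M e))))

M≤a0-nOf : ∀ {M i k₁ k₂} → 4 * M < i → IsCeilLog i 2 k₁ → IsCeilLog i 4 k₂ →
           M ≤ a0 (nOf i k₁ k₂)
M≤a0-nOf {i = zero} ()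
M≤a0-nOf {M} {i@(suc _)} 4M<i ceil₁@(_ , small) ceil₂@(4iᵏ≤sᵏ , _)
  with k₂≤2k₁ , 2k₁≤1+k₂ ← ceilLog-square {c = 2} ceil₁ ceil₂
     | m≤n⇒m<n∨m≡n k₂≤2k₁
... | inj₂ refl    =
  M≤a0-nOf-square (2*m<i⇒m<ceilLog ceil₁ (≤-<-trans (*-monoˡ-≤ M {2} {4} (s≤s (s≤s z≤n))) 4M<i)) small
... | inj₁ k₂<2k₁ =
  M≤a0-nOf-odd 4M<i ceil₁ 4iᵏ≤sᵏ (≤-antisym k₂<2k₁ 2k₁≤1+k₂)

a0-unbounded : ∀ M N → ∃ λ n → N ≤ n × 1 ≤ n × M ≤ a0 n
a0-unbounded M N =
  n , N≤n , nOf-positive i (suc M) (2 * suc M) ,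
  a0-nOf-square i M (λ m m≤M → [1+i]^m<2*i^m i m (s≤s (*-monoʳ-≤ 2 (≤-trans m≤M (m≤m+n M N)))))
  where
  i = suc (2 * (M + N))
  n = nOf i (suc M) (2 * suc M)
  N≤n : N ≤ n
  N≤n = begin
    N                ≤⟨ m≤n+m N M ⟩
    M + N            ≤⟨ m≤n*m (M + N) 2 ⟩
    2 * (M + N)      ≤⟨ n≤1+n _ ⟩
    i                ≤⟨ m≤m*n i (i ^ (M + suc (M + 0))) ⟩
    i ^ (2 * suc M)  ≤⟨ m≤n*m (i ^ (2 * suc M)) (2 * suc i ^ (2 * suc M)) ⟩
    n                ∎
    where
    open ≤-Reasoning
    instance
      _ = m^n≢0 i (M + suc (M + 0))
      _ = m^n≢0 (suc i) (2 * suc M)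
      _ = m*n≢0 2 (suc i ^ (2 * suc M))

mainTheorem1 :
    -- limsup_{n→∞} a_{n,0} = ∞
    (∀ (M N : ℕ) → ∃ λ n → N ≤ n × 1 ≤ n × M ≤ a0 n)
    ×
    -- lim_{i→∞} a_{n(i),0} = ∞, with k1 = ⌈s_max(i)⌉, k2 = ⌈2 s_max(i)⌉
    (∀ (M : ℕ) → ∃ λ N → ∀ (i : ℕ) → 1 ≤ i → N ≤ i →
       ∀ (k1 k2 : ℕ) → IsCeilLog i 2 k1 → IsCeilLog i 4 k2 →
       M ≤ a0 (nOf i k1 k2))
mainTheorem1 = a0-unbounded , λ M → suc (4 * M) , λ i _ 4M<i _ _ → M≤a0-nOf 4M<i
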